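{- Let $b\ge 1$ be an integer and let $\alpha,\beta\in\mathbb{Z}/b\mathbb{Z}$. Then there exist $i_1,i_2\in\mathbb{Z}/b\mathbb{Z}$ such that, setting $u_{ -1}=\alpha$, $u_0=\beta$, $u_1=i_1u_0+u_{ -1}$ and $u_2=i_2u_1+u_0$, one has $u_2=0$ in $\mathbb{Z}/b\mathbb{Z}$. -}

module Defs where

open import Data.Integer using (ℤ; _+_; _*_)

-- Z/bZ is modelled by integer representatives; equality in Z/bZ is
-- congruence modulo b (b ∣ difference). The recurrence from the statement:
-- u₋₁ = α, u₀ = β, u₁ = i₁ u₀ + u₋₁, u₂ = i₂ u₁ + u₀.
u₁ : ℤ → ℤ → ℤ → ℤ
u₁ α β i₁ = i₁ * β + α

u₂ : ℤ → ℤ → ℤ → ℤ → ℤ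
u₂ α β i₁ i₂ = i₂ * u₁ α β i₁ + β

{-# OPTIONS --safe #-}
-- Reduce α, β to residues A, B and write A = g a, B = g c with a, c coprime.
-- If t is the largest divisor of b coprime to a, then a + t c is coprime to b:
-- a prime factor of b dividing a divides neither c nor t, and one not dividing
-- a divides t. Choosing x with x (a + t c) ≡ -1 mod b, the multipliers
-- i₁ = t, i₂ = c x give u₂ = g c (x (a + t c) + 1) ≡ 0.
module Submission where

open import Defs

module CoprimeTranslate where
  open import Data.Nat
  open import Data.Nat.Properties
  open import Data.Nat.Divisibility
  open import Data.Nat.DivMod
  open import Data.Nat.GCD
  open import Data.Nat.Coprimality using (Coprime; gcd≡1⇒coprime; coprime-divisor; coprime-Bézout; coprime-/gcd)
  open import Data.Nat.Induction using (<-wellFounded)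
  open import Induction.WellFounded using (Acc; acc)
  open import Data.Product
  open import Data.Sum using (inj₁)
  open import Relation.Binary.PropositionalEquality
  open import Relation.Nullary
  open import Function using (_∘′_)
  open import Data.Nat.Tactic.RingSolver using (solve-∀)

  coprime-∣ʳ : ∀ {m n d} → Coprime m n → d ∣ n → Coprime m d
  coprime-∣ʳ m⊥n d∣n (h∣m , h∣d) = m⊥n (h∣m , ∣-trans h∣d d∣n)

  -- maximal: every prime factor of m not dividing a divides part.
  record CoprimePart (a m : ℕ) : Set where
    field
      part    : ℕ
      part∣m  : part ∣ m
      part⊥a  : Coprime part a
      maximal : ∀ {e} → e ∣ m → Coprime e a → Coprime e part → e ≡ 1

  coprimePart-whole : ∀ {a m} → Coprime m a → CoprimePart a m
  coprimePart-whole {m = m} m⊥a = record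
    { part = m ; part∣m = ∣-refl ; part⊥a = m⊥a
    ; maximal = λ e∣m _ e⊥m → e⊥m (∣-refl , e∣m) }

  coprimePart-*ˡ : ∀ {a g n} → g ∣ a → CoprimePart a n → CoprimePart a (g * n)
  coprimePart-*ˡ {g = g} g∣a p = record
    { part = part ; part∣m = ∣-trans part∣m (n∣m*n g) ; part⊥a = part⊥a
    ; maximal = λ e∣gn e⊥a → maximal (coprime-divisor (coprime-∣ʳ e⊥a g∣a) e∣gn) e⊥a }
    where open CoprimePart p

  coprimePart-acc : ∀ a m .{{_ : NonZero m}} → Acc _<_ m → CoprimePart a m
  coprimePart-acc a m (acc rs) with gcd m a ≟ 1
  ... | yes g≡1 = coprimePart-whole (gcd≡1⇒coprime g≡1)
  ... | no g≢1 = subst (CoprimePart a) (m*[n/m]≡n (gcd[m,n]∣m m a))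
                   (coprimePart-*ˡ (gcd[m,n]∣n m a) (coprimePart-acc a (m / g) (rs (m/n<m m g 1<g))))
    where
    g = gcd m a
    g≢0 : g ≢ 0
    g≢0 = gcd[m,n]≢0 m a (inj₁ (≢-nonZero⁻¹ m))
    instance
      g-nonZero : NonZero g
      g-nonZero = ≢-nonZero g≢0
      m/g-nonZero : NonZero (m / g)
      m/g-nonZero = ≢-nonZero (m/gcd[m,n]≢0 m a)
    1<g : 1 < g
    1<g = ≤∧≢⇒< (n≢0⇒n>0 g≢0) (g≢1 ∘′ sym)

  coprimePart : ∀ a m .{{_ : NonZero m}} → CoprimePart a m
  coprimePart a m = coprimePart-acc a m (<-wellFounded m)

  coprime-translate : ∀ {a c} b .{{_ : NonZero b}} → Coprime a c → ∃ λ t → Coprime (a + t * c) b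
  coprime-translate {a} {c} b a⊥c = part , λ (f∣s , f∣b) → maximal f∣b (f⊥a f∣s) (f⊥part f∣s)
    where
    open CoprimePart (coprimePart a b)
    f⊥a : ∀ {f} → f ∣ a + part * c → Coprime f a
    f⊥a f∣s {h} (h∣f , h∣a) = part⊥a (h∣part , h∣a)
      where
      h⊥c : Coprime h c
      h⊥c (d∣h , d∣c) = a⊥c (∣-trans d∣h h∣a , d∣c)
      h∣part : h ∣ part
      h∣part = coprime-divisor h⊥c (subst (h ∣_) (*-comm part c) (∣m+n∣m⇒∣n (∣-trans h∣f f∣s) h∣a))
    f⊥part : ∀ {f} → f ∣ a + part * c → Coprime f part
    f⊥part f∣s {h} (h∣f , h∣part) = part⊥a (h∣part , h∣a)
      where
      h∣a : h ∣ a
      h∣a = ∣m+n∣m⇒∣n (subst (h ∣_) (+-comm a (part * c)) (∣-trans h∣f f∣s)) (∣m⇒∣m*n c h∣part)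

  coprime⇒∃[x]b∣x*n+1 : ∀ {n} b .{{_ : NonZero b}} → Coprime n b → ∃ λ x → b ∣ x * n + 1
  coprime⇒∃[x]b∣x*n+1 {n} b@(suc b₀) n⊥b with coprime-Bézout n⊥b
  ... | Bézout.-+ x y 1+xn≡yb = x , divides y (trans (+-comm (x * n) 1) 1+xn≡yb)
  ... | Bézout.+- x y 1+yb≡xn = b₀ * x , divides (b₀ * y + 1) (begin
          b₀ * x * n + 1       ≡⟨ cong (_+ 1) (*-assoc b₀ x n) ⟩
          b₀ * (x * n) + 1     ≡⟨ cong (λ xn → b₀ * xn + 1) 1+yb≡xn ⟨
          b₀ * (1 + y * b) + 1 ≡⟨ expand b₀ y ⟩
          (b₀ * y + 1) * b     ∎)
    where
    open ≡-Reasoning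
    expand : ∀ b₀ y → b₀ * (1 + y * suc b₀) + 1 ≡ (b₀ * y + 1) * suc b₀
    expand = solve-∀

  ∃[t,s]b∣s*[t*B+A]+B : ∀ A B b .{{_ : NonZero b}} → ∃₂ λ t s → b ∣ s * (t * B + A) + B
  ∃[t,s]b∣s*[t*B+A]+B A B b with gcd A B ≟ 0
  ... | yes g≡0 rewrite gcd[m,n]≡0⇒m≡0 {A} {B} g≡0 | gcd[m,n]≡0⇒n≡0 A {B} g≡0 = 0 , 0 , b ∣0
  ... | no g≢0 = t , c * x , subst (b ∣_) (sym equation) (∣n⇒∣m*n (g * c) (proj₂ inverse))
    where
    g = gcd A B
    instance
      g-nonZero : NonZero g
      g-nonZero = ≢-nonZero g≢0
    a c : ℕ
    a = A / g
    c = B / g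
    translate : ∃ λ t → Coprime (a + t * c) b
    translate = coprime-translate b (coprime-/gcd A B)
    t = proj₁ translate
    inverse : ∃ λ x → b ∣ x * (a + t * c) + 1
    inverse = coprime⇒∃[x]b∣x*n+1 b (proj₂ translate)
    x = proj₁ inverse
    equation : c * x * (t * B + A) + B ≡ g * c * (x * (a + t * c) + 1)
    equation = begin
      c * x * (t * B + A) + B               ≡⟨ cong₂ (λ B A → c * x * (t * B + A) + B) (m*[n/m]≡n (gcd[m,n]∣n A B)) (m*[n/m]≡n (gcd[m,n]∣m A B)) ⟨
      c * x * (t * (g * c) + g * a) + g * c ≡⟨ factorise g a c t x ⟩
      g * c * (x * (a + t * c) + 1)         ∎
      where
      open ≡-Reasoning
      factorise : ∀ g a c t x → c * x * (t * (g * c) + g * a) + g * c ≡ g * c * (x * (a + t * c) + 1)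
      factorise = solve-∀

module ModularReduction where
  import Data.Nat as ℕ
  open import Data.Integer
  open import Data.Integer.Properties using (pos-+; pos-*)
  open import Data.Integer.DivMod using (a≡a%ℕn+[a/ℕn]*n)
  open import Data.Integer.Divisibility.Signed using (_∣_; ∣-refl; ∣m∣n⇒∣m+n; ∣n⇒∣m*n)
  open import Data.Integer.Tactic.RingSolver using (solve-∀)
  open import Relation.Binary.PropositionalEquality

  u₂-+ : ∀ A B t s → u₂ (+ A) (+ B) (+ t) (+ s) ≡ + (s ℕ.* (t ℕ.* B ℕ.+ A) ℕ.+ B)
  u₂-+ A B t s = sym (begin
    + (s ℕ.* (t ℕ.* B ℕ.+ A) ℕ.+ B)  ≡⟨ pos-+ (s ℕ.* (t ℕ.* B ℕ.+ A)) B ⟩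
    + (s ℕ.* (t ℕ.* B ℕ.+ A)) + + B  ≡⟨ cong (_+ + B) (pos-* s (t ℕ.* B ℕ.+ A)) ⟩
    + s * + (t ℕ.* B ℕ.+ A) + + B    ≡⟨ cong (λ u → + s * u + + B) (pos-+ (t ℕ.* B) A) ⟩
    + s * (+ (t ℕ.* B) + + A) + + B  ≡⟨ cong (λ u → + s * (u + + A) + + B) (pos-* t B) ⟩
    + s * (+ t * + B + + A) + + B    ∎)
    where open ≡-Reasoning

  u₂-+-multiples : ∀ α β p q b i j →
    u₂ (α + p * b) (β + q * b) i j ≡ u₂ α β i j + (j * i * q + j * p + q) * b
  u₂-+-multiples α β p q b i j = identity α β p q b i j
    where
    identity : ∀ α β p q b i j →
      j * (i * (β + q * b) + (α + p * b)) + (β + q * b)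
        ≡ j * (i * β + α) + β + (j * i * q + j * p + q) * b
    identity = solve-∀

  u₂-%ℕ : ∀ b .{{_ : ℕ.NonZero b}} α β i j →
    + b ∣ u₂ (+ (α %ℕ b)) (+ (β %ℕ b)) i j → + b ∣ u₂ α β i j
  u₂-%ℕ b α β i j b∣u₂ = subst (+ b ∣_) (sym u₂≡) (∣m∣n⇒∣m+n b∣u₂ (∣n⇒∣m*n w ∣-refl))
    where
    w = j * i * (β /ℕ b) + j * (α /ℕ b) + β /ℕ b
    u₂≡ : u₂ α β i j ≡ u₂ (+ (α %ℕ b)) (+ (β %ℕ b)) i j + w * + b
    u₂≡ = trans (cong₂ (λ α β → u₂ α β i j) (a≡a%ℕn+[a/ℕn]*n α b) (a≡a%ℕn+[a/ℕn]*n β b))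
                (u₂-+-multiples _ _ (α /ℕ b) (β /ℕ b) (+ b) i j)

open import Data.Nat using (ℕ; _≥_; zero; suc)
open import Data.Integer using (ℤ; +_; _%ℕ_)
open import Data.Integer.Divisibility using (_∣_)
open import Data.Integer.Divisibility.Signed using (∣ᵤ⇒∣; ∣⇒∣ᵤ)
open import Data.Product using (∃₂; _,_)
open import Relation.Binary.PropositionalEquality using (subst; sym)
open CoprimeTranslate using (∃[t,s]b∣s*[t*B+A]+B)
open ModularReduction using (u₂-+; u₂-%ℕ)

lemma3p15 : (b : ℕ) → b ≥ 1 → (α β : ℤ) →
    ∃₂ λ (i₁ i₂ : ℤ) → (+ b) ∣ u₂ α β i₁ i₂
lemma3p15 zero () α β
lemma3p15 b@(suc _) _ α β with ∃[t,s]b∣s*[t*B+A]+B (α %ℕ b) (β %ℕ b) b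
... | t , s , b∣u₂[A,B] = + t , + s , ∣⇒∣ᵤ (u₂-%ℕ b α β (+ t) (+ s) (∣ᵤ⇒∣ b∣u₂))
  where
  b∣u₂ : + b ∣ u₂ (+ (α %ℕ b)) (+ (β %ℕ b)) (+ t) (+ s)
  b∣u₂ = subst (+ b ∣_) (sym (u₂-+ (α %ℕ b) (β %ℕ b) t s)) b∣u₂[A,B]
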